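{- Let $T$ be a strongly connected tournament on $n$ vertices which has an edge $e$ from $u$ to $v$ such that every directed cycle of $T$ contains $e$. Then $T$ is isomorphic to $D_n$ via an isomorphism mapping $u$ to $v_n$ and $v$ to $v_1$.
   Context: $D_n$ is the tournament on vertex set $\{v_1,\ldots,v_n\}$ in which, for $1\leq i<j\leq n$ with $(i,j)\neq(1,n)$, the edge between $v_i$ and $v_j$ is oriented from $v_i$ to $v_j$, and the edge between $v_1$ and $v_n$ is oriented from $v_n$ to $v_1$. -}

module Defs where

open import Data.Nat using (ℕ; zero; suc; _<_; _∸_)
open import Data.Fin using (Fin; toℕ)
open import Data.List using (List; []; _∷_)
open import Data.List.Relation.Unary.All using (All)
open import Data.List.Relation.Unary.Unique.Propositional using (Unique)
open import Data.List.Membership.Propositional using (_∈_)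
open import Data.Product using (Σ; _×_; _,_; proj₁; proj₂)
open import Data.Sum using (_⊎_)
open import Data.Empty using (⊥)
open import Relation.Nullary using (¬_)
open import Relation.Binary.PropositionalEquality using (_≡_; _≢_)
open import Function.Bundles using (_⤖_; Bijection)

record Tournament (n : ℕ) : Set₁ where
  field
    _⇒_        : Fin n → Fin n → Set
    irrefl     : ∀ x → ¬ (x ⇒ x)
    total      : ∀ x y → x ≢ y → (x ⇒ y) ⊎ (y ⇒ x)
    antisym    : ∀ x y → x ⇒ y → y ⇒ x → ⊥

open Tournament public

data Path {n : ℕ} (T : Tournament n) : Fin n → Fin n → Set where
  here : ∀ {x} → Path T x x
  step : ∀ {x y z} → _⇒_ T x y → Path T y z → Path T x z

StronglyConnected : ∀ {n} → Tournament n → Set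
StronglyConnected T = ∀ x y → Path T x y

consecPairs : ∀ {A : Set} → A → A → List A → List (A × A)
consecPairs first prev []       = (prev , first) ∷ []
consecPairs first prev (y ∷ ys) = (prev , y) ∷ consecPairs first y ys

cycleArcs : ∀ {n} → Fin n → List (Fin n) → List (Fin n × Fin n)
cycleArcs x xs = consecPairs x x xs

record DirectedCycle {n : ℕ} (T : Tournament n) : Set where
  field
    start    : Fin n
    rest     : List (Fin n)
    distinct : Unique (start ∷ rest)
    arcs     : All (λ p → _⇒_ T (proj₁ p) (proj₂ p)) (cycleArcs start rest)

open DirectedCycle public

ContainsArc : ∀ {n} {T : Tournament n} → DirectedCycle T → Fin n → Fin n → Set
ContainsArc C a b = (a , b) ∈ cycleArcs (start C) (rest C)

-- The tournament D_n on Fin n, where index i stands for v_{i+1}: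
-- i → j iff (i < j and (i , j) ≠ (0 , n-1)), or (i , j) = (n-1 , 0).
DEdge : (n : ℕ) → Fin n → Fin n → Set
DEdge n i j =
  (toℕ i < toℕ j × ¬ (toℕ i ≡ 0 × toℕ j ≡ n ∸ 1))
  ⊎ (toℕ i ≡ n ∸ 1 × toℕ j ≡ 0)

record IsoToD {n : ℕ} (T : Tournament n) : Set where
  field
    f        : Fin n ⤖ Fin n
    preserve : ∀ x y → _⇒_ T x y → DEdge n (Bijection.to f x) (Bijection.to f y)
    reflect  : ∀ x y → DEdge n (Bijection.to f x) (Bijection.to f y) → _⇒_ T x y

open IsoToD public

module Submission where

-- Idea: reversing the arc u → v yields a transitive tournament ≺.  Every
-- triangle is a directed cycle, so in T − uv two consecutive arcs can only
-- be closed back by u → v; strong connectivity then shows that v has no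
-- in-neighbour other than u and u no out-neighbour other than v, which makes
-- v the least and u the greatest element of ≺ and ≺ transitive.  Ranking
-- the strict total order ≺ (rank x = number of elements below x) gives a
-- permutation of Fin n that sends v to 0, u to n-1, arcs of T − uv to
-- increasing pairs and u → v to the pair (n-1, 0): exactly the arcs of D_n.

open import Defs

open import Data.Nat using (ℕ; zero; suc; _<_; _∸_)
open import Data.Nat.Properties using (<-irrefl; <-asym)
open import Data.Fin using (Fin; toℕ; fromℕ<; punchOut)
open import Data.Fin.Properties using (_≟_; any?; toℕ-fromℕ<; injective⇒≤; punchOut-injective)
open import Data.Fin.Subset using (Subset; _∈_; _∉_; _⊆_; ⊤; ⊥; ∁; ⁅_⁆; ∣_∣)
open import Data.Fin.Subset.Properties
  using (∈⊤; ⊆⊤; ⊥⊆; p⊂q⇒∣p∣<∣q∣; ∣⊤∣≡n; ∣⊥∣≡0; ∣∁p∣≡n∸∣p∣; ∣⁅x⁆∣≡1; ⊆-antisym;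
         x∈∁p⇒x∉p; x∉p⇒x∈∁p; x∉⁅y⁆⇒x≢y; x≢y⇒x∉⁅y⁆)
open import Data.Vec using (tabulate)
open import Data.Vec.Properties using ([]=⇒lookup; lookup⇒[]=; lookup∘tabulate)
open import Data.Bool using (true)
open import Data.List using (_∷_; [])
open import Data.List.Relation.Unary.All using ([]; _∷_)
open import Data.List.Relation.Unary.AllPairs using ([]; _∷_)
open import Data.List.Relation.Unary.Any using (here; there)
open import Data.List.Membership.Propositional using () renaming (_∈_ to _∈ₗ_)
open import Data.Product using (Σ; _×_; _,_; proj₁; proj₂)
open import Data.Sum using (_⊎_; inj₁; inj₂; [_,_]′)
open import Data.Empty using (⊥-elim)
open import Relation.Nullary using (¬_; Dec; yes; no; does)
open import Relation.Nullary.Decidable using (dec-true)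
open import Relation.Binary.Definitions using (Transitive; Decidable; Irreflexive; Asymmetric; Trichotomous; tri<; tri≈; tri>)
open import Relation.Binary.Structures using (IsStrictTotalOrder)
open import Relation.Binary.PropositionalEquality using (_≡_; _≢_; refl; sym; trans; cong; subst; subst₂; resp₂; isEquivalence; module ≡-Reasoning)
open import Function using (_∘_; id)
open import Function.Bundles using (Bijection; _⤖_; mk⤖)
open import Function.Definitions using (Injective; Surjective)

-- An injective map from a finite set to itself is onto: a missed point y
-- would let the map factor injectively through Fin m ≅ Fin (suc m) ∖ {y}.
injective⇒surjective : ∀ {n} (h : Fin n → Fin n) → Injective _≡_ _≡_ h → Surjective _≡_ _≡_ h
injective⇒surjective {zero}  h h-inj ()
injective⇒surjective {suc m} h h-inj y with any? (λ x → h x ≟ y)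
... | yes (x , hx≡y) = x , λ { refl → hx≡y }
... | no missed = ⊥-elim (<-irrefl refl (injective⇒≤ {f = squeeze} squeeze-inj))
  where
    hits : ∀ x → y ≢ h x
    hits x y≡hx = missed (x , sym y≡hx)
    squeeze : Fin (suc m) → Fin m
    squeeze x = punchOut (hits x)
    squeeze-inj : Injective _≡_ _≡_ squeeze
    squeeze-inj {x} {x′} eq = h-inj (punchOut-injective (hits x) (hits x′) eq)

trichotomous : ∀ {A : Set} {_<_ : A → A → Set} → Decidable {A = A} _≡_ →
  Irreflexive _≡_ _<_ → Asymmetric _<_ → (∀ {x y} → x ≢ y → x < y ⊎ y < x) →
  Trichotomous _≡_ _<_
trichotomous eq? irr asym connex x y with eq? x y
... | yes x≡y = tri≈ (irr x≡y) x≡y (irr (sym x≡y))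
... | no x≢y with connex x≢y
...   | inj₁ x<y = tri< x<y x≢y (asym x<y)
...   | inj₂ y<x = tri> (asym y<x) x≢y y<x

module Ranking {n : ℕ} {_≺_ : Fin n → Fin n → Set} (isSTO : IsStrictTotalOrder _≡_ _≺_) where
  open IsStrictTotalOrder isSTO
    using (compare; _<?_) renaming (irrefl to ≺-irrefl; asym to ≺-asym; trans to ≺-trans)

  predecessors : Fin n → Subset n
  predecessors x = tabulate (λ y → does (y <? x))

  ∈-predecessors⁺ : ∀ {x y} → y ≺ x → y ∈ predecessors x
  ∈-predecessors⁺ {x} {y} y≺x =
    lookup⇒[]= y _ (trans (lookup∘tabulate _ y) (dec-true (y <? x) y≺x))

  ∈-predecessors⁻ : ∀ {x y} → y ∈ predecessors x → y ≺ x
  ∈-predecessors⁻ {x} {y} y∈ =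
    witness (y <? x) (trans (sym (lookup∘tabulate _ y)) ([]=⇒lookup y∈))
    where
      witness : (d : Dec (y ≺ x)) → does d ≡ true → y ≺ x
      witness (yes y≺x) _ = y≺x
      witness (no _) ()

  rank : Fin n → ℕ
  rank x = ∣ predecessors x ∣

  -- x itself is missing from its predecessors, so rank x < n.
  rank<n : ∀ x → rank x < n
  rank<n x = subst (rank x <_) (∣⊤∣≡n n)
    (p⊂q⇒∣p∣<∣q∣ (⊆⊤ , x , ∈⊤ , ≺-irrefl refl ∘ ∈-predecessors⁻))

  -- Ranks are strictly monotone: going up gains at least x itself.
  rank-mono : ∀ {x y} → x ≺ y → rank x < rank y
  rank-mono {x} x≺y = p⊂q⇒∣p∣<∣q∣
    ( (λ z∈ → ∈-predecessors⁺ (≺-trans (∈-predecessors⁻ z∈) x≺y))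
    , x , ∈-predecessors⁺ x≺y , ≺-irrefl refl ∘ ∈-predecessors⁻ )

  rank-reflect : ∀ {x y} → rank x < rank y → x ≺ y
  rank-reflect {x} {y} lt with compare x y
  ... | tri< x≺y _ _ = x≺y
  ... | tri≈ _ refl _ = ⊥-elim (<-irrefl refl lt)
  ... | tri> _ _ y≺x = ⊥-elim (<-asym lt (rank-mono y≺x))

  rank-injective : ∀ {x y} → rank x ≡ rank y → x ≡ y
  rank-injective {x} {y} eq with compare x y
  ... | tri< x≺y _ _ = ⊥-elim (<-irrefl eq (rank-mono x≺y))
  ... | tri≈ _ x≡y _ = x≡y
  ... | tri> _ _ y≺x = ⊥-elim (<-irrefl (sym eq) (rank-mono y≺x))

  rank-least : ∀ {x} → (∀ y → y ≢ x → x ≺ y) → rank x ≡ 0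
  rank-least {x} least = trans (cong ∣_∣ (⊆-antisym none ⊥⊆)) (∣⊥∣≡0 n)
    where
      none : predecessors x ⊆ ⊥
      none {y} y∈ with y ≟ x
      ... | yes refl = ⊥-elim (≺-irrefl refl (∈-predecessors⁻ y∈))
      ... | no y≢x = ⊥-elim (≺-asym (∈-predecessors⁻ y∈) (least y y≢x))

  rank-greatest : ∀ {x} → (∀ y → y ≢ x → y ≺ x) → rank x ≡ n ∸ 1
  rank-greatest {x} greatest = begin
    ∣ predecessors x ∣ ≡⟨ cong ∣_∣ (⊆-antisym (x∉p⇒x∈∁p ∘ others) all-others) ⟩
    ∣ ∁ ⁅ x ⁆ ∣        ≡⟨ ∣∁p∣≡n∸∣p∣ ⁅ x ⁆ ⟩
    n ∸ ∣ ⁅ x ⁆ ∣      ≡⟨ cong (n ∸_) (∣⁅x⁆∣≡1 x) ⟩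
    n ∸ 1              ∎
    where
      open ≡-Reasoning
      others : ∀ {y} → y ∈ predecessors x → y ∉ ⁅ x ⁆
      others y∈ = x≢y⇒x∉⁅y⁆ (λ { refl → ≺-irrefl refl (∈-predecessors⁻ y∈) })
      all-others : ∁ ⁅ x ⁆ ⊆ predecessors x
      all-others y∈ = ∈-predecessors⁺ (greatest _ (x∉⁅y⁆⇒x≢y (x∈∁p⇒x∉p y∈)))

  ranking : Fin n → Fin n
  ranking x = fromℕ< (rank<n x)

  toℕ-ranking : ∀ x → toℕ (ranking x) ≡ rank x
  toℕ-ranking x = toℕ-fromℕ< (rank<n x)

  ranking-bijection : Fin n ⤖ Fin n
  ranking-bijection = mk⤖ (ranking-injective , injective⇒surjective ranking ranking-injective)
    where
      ranking-injective : Injective _≡_ _≡_ ranking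
      ranking-injective {x} {y} eq = rank-injective (begin
        rank x           ≡⟨ sym (toℕ-ranking x) ⟩
        toℕ (ranking x)  ≡⟨ cong toℕ eq ⟩
        toℕ (ranking y)  ≡⟨ toℕ-ranking y ⟩
        rank y           ∎)
        where open ≡-Reasoning

path-backward : ∀ {n} {T : Tournament n} (S : Fin n → Set) →
  (∀ {x y} → _⇒_ T x y → S y → S x) → ∀ {a b} → Path T a b → S b → S a
path-backward S closed here        sb = sb
path-backward S closed (step xy p) sb = closed xy (path-backward S closed p sb)

path-forward : ∀ {n} {T : Tournament n} (S : Fin n → Set) →
  (∀ {x y} → _⇒_ T x y → S x → S y) → ∀ {a b} → Path T a b → S a → S b
path-forward S closed here        sa = sa
path-forward S closed (step xy p) sa = path-forward S closed p (closed xy sa)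

-- The D_n adjacency read on indices in ℕ; DEdge n i j unfolds to
-- DArc n (toℕ i) (toℕ j).
DArc : ℕ → ℕ → ℕ → Set
DArc n a b = (a < b × ¬ (a ≡ 0 × b ≡ n ∸ 1)) ⊎ (a ≡ n ∸ 1 × b ≡ 0)

module ArcOnEveryCycle {n : ℕ} (T : Tournament n) (strong : StronglyConnected T)
    (u v : Fin n) (u↝v : _⇒_ T u v) (onEveryCycle : (C : DirectedCycle T) → ContainsArc C u v) where

  infix 4 _↝_ _⇀_ _≺_

  _↝_ : Fin n → Fin n → Set
  a ↝ b = _⇒_ T a b

  arc-distinct : ∀ {a b} → a ↝ b → a ≢ b
  arc-distinct {a} a↝a refl = irrefl T a a↝a

  u≢v : u ≢ v
  u≢v = arc-distinct u↝v

  _⇀_ : Fin n → Fin n → Set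
  a ⇀ b = a ↝ b × ¬ (a ≡ u × b ≡ v)

  arc-split : ∀ {a b} → a ↝ b → a ⇀ b ⊎ (a ≡ u × b ≡ v)
  arc-split {a} {b} a↝b with a ≟ u | b ≟ v
  ... | yes a≡u | yes b≡v = inj₂ (a≡u , b≡v)
  ... | no a≢u  | _       = inj₁ (a↝b , a≢u ∘ proj₁)
  ... | yes _   | no b≢v  = inj₁ (a↝b , b≢v ∘ proj₂)

  -- A triangle a → b → c → a is a directed cycle, so it must use u → v; if
  -- its first two arcs avoid u → v, the closing arc is u → v.
  closing-arc : ∀ {a b c} → a ⇀ b → b ⇀ c → c ↝ a → c ≡ u × a ≡ v
  closing-arc {a} {b} {c} (a↝b , a↝b≠uv) (b↝c , b↝c≠uv) c↝a = locate (onEveryCycle triangle)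
    where
      triangle : DirectedCycle T
      triangle = record
        { start    = a
        ; rest     = b ∷ c ∷ []
        ; distinct = (arc-distinct a↝b ∷ (arc-distinct c↝a ∘ sym) ∷ [])
                   ∷ (arc-distinct b↝c ∷ []) ∷ [] ∷ []
        ; arcs     = a↝b ∷ b↝c ∷ c↝a ∷ [] }
      locate : (u , v) ∈ₗ cycleArcs a (b ∷ c ∷ []) → c ≡ u × a ≡ v
      locate (here refl)                 = ⊥-elim (a↝b≠uv (refl , refl))
      locate (there (here refl))         = ⊥-elim (b↝c≠uv (refl , refl))
      locate (there (there (here refl))) = refl , refl

  shortcut : ∀ {a b c} → a ⇀ b → b ⇀ c → a ≢ c → ¬ (a ≡ v × c ≡ u) → a ↝ c
  shortcut {a} {b} {c} a⇀b b⇀c a≢c not-v→u with total T a c a≢c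
  ... | inj₁ a↝c = a↝c
  ... | inj₂ c↝a with closing-arc a⇀b b⇀c c↝a
  ...   | c≡u , a≡v = ⊥-elim (not-v→u (a≡v , c≡u))

  -- Strong connectivity forces v to have no in-neighbour but u: if w → v with
  -- w ≠ u, the elements reaching w inside T − uv (or equal to w) form a set
  -- closed under in-neighbours; v reaches w, so v would be in it.
  in-arc-of-v : ∀ {w} → w ↝ v → w ≡ u
  in-arc-of-v {w} w↝v with w ≟ u
  ... | yes w≡u = w≡u
  ... | no w≢u  = ⊥-elim (v∉S (path-backward S closed (strong v w) (inj₁ refl)))
    where
      S : Fin n → Set
      S x = x ≡ w ⊎ x ⇀ w
      v∉S : ¬ S v
      v∉S (inj₁ v≡w)       = arc-distinct w↝v (sym v≡w)
      v∉S (inj₂ (v↝w , _)) = antisym T w v w↝v v↝w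
      closed : ∀ {y x} → y ↝ x → S x → S y
      closed {y} y↝x sx with y ≟ w | arc-split y↝x
      ... | yes y≡w | _                 = inj₁ y≡w
      ... | no _    | inj₂ (refl , refl) = ⊥-elim (v∉S sx)
      ... | no y≢w  | inj₁ y⇀x with sx
      ...   | inj₁ refl = inj₂ y⇀x
      ...   | inj₂ x⇀w  = inj₂ ( shortcut y⇀x x⇀w y≢w (w≢u ∘ proj₂)
                               , arc-distinct w↝v ∘ proj₂ )

  -- Dually, u has no out-neighbour but v: the elements reachable from w
  -- inside T − uv (or equal to w) are closed under out-neighbours.
  out-arc-of-u : ∀ {w} → u ↝ w → w ≡ v
  out-arc-of-u {w} u↝w with w ≟ v
  ... | yes w≡v = w≡v
  ... | no w≢v  = ⊥-elim (u∉S (path-forward S closed (strong w u) (inj₁ refl)))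
    where
      S : Fin n → Set
      S x = x ≡ w ⊎ w ⇀ x
      u∉S : ¬ S u
      u∉S (inj₁ u≡w)       = arc-distinct u↝w u≡w
      u∉S (inj₂ (w↝u , _)) = antisym T u w u↝w w↝u
      closed : ∀ {x y} → x ↝ y → S x → S y
      closed {y = y} x↝y sx with y ≟ w | arc-split x↝y
      ... | yes y≡w | _                 = inj₁ y≡w
      ... | no _    | inj₂ (refl , refl) = ⊥-elim (u∉S sx)
      ... | no y≢w  | inj₁ x⇀y with sx
      ...   | inj₁ refl = inj₂ x⇀y
      ...   | inj₂ w⇀x  = inj₂ ( shortcut w⇀x x⇀y (y≢w ∘ sym) (w≢v ∘ proj₁)
                               , arc-distinct u↝w ∘ sym ∘ proj₁ )

  _≺_ : Fin n → Fin n → Set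
  a ≺ b = a ⇀ b ⊎ (a ≡ v × b ≡ u)

  nothing-below-v : ∀ {x} → ¬ x ≺ v
  nothing-below-v (inj₁ (x↝v , x↝v≠uv)) = x↝v≠uv (in-arc-of-v x↝v , refl)
  nothing-below-v (inj₂ (_ , v≡u))      = u≢v (sym v≡u)

  nothing-above-u : ∀ {x} → ¬ u ≺ x
  nothing-above-u (inj₁ (u↝x , u↝x≠uv)) = u↝x≠uv (refl , out-arc-of-u u↝x)
  nothing-above-u (inj₂ (u≡v , _))      = u≢v u≡v

  v-least : ∀ x → x ≢ v → v ≺ x
  v-least x x≢v with x ≟ u
  ... | yes refl = inj₂ (refl , refl)
  ... | no x≢u with total T v x (x≢v ∘ sym)
  ...   | inj₁ v↝x = inj₁ (v↝x , u≢v ∘ sym ∘ proj₁)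
  ...   | inj₂ x↝v = ⊥-elim (x≢u (in-arc-of-v x↝v))

  u-greatest : ∀ x → x ≢ u → x ≺ u
  u-greatest x x≢u with x ≟ v
  ... | yes refl = inj₂ (refl , refl)
  ... | no x≢v with total T x u x≢u
  ...   | inj₁ x↝u = inj₁ (x↝u , u≢v ∘ proj₂)
  ...   | inj₂ u↝x = ⊥-elim (x≢v (out-arc-of-u u↝x))

  -- Away from the two extremes, ≺ coincides with T − uv, which is
  -- transitive there by the shortcut lemma.
  ≺-trans : Transitive _≺_
  ≺-trans {z} {x} {y} z≺x x≺y with z ≟ v | y ≟ u
  ... | yes refl | _        = v-least y (λ { refl → nothing-below-v x≺y })
  ... | no _     | yes refl = u-greatest z (λ { refl → nothing-above-u z≺x })
  ... | no z≢v   | no y≢u   = inj₁ (shortcut z⇀x x⇀y z≢y (z≢v ∘ proj₁) , z≢u ∘ proj₁)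
    where
      z⇀x : z ⇀ x
      z⇀x = [ id , (λ p → ⊥-elim (z≢v (proj₁ p))) ]′ z≺x
      x⇀y : x ⇀ y
      x⇀y = [ id , (λ p → ⊥-elim (y≢u (proj₂ p))) ]′ x≺y
      z≢y : z ≢ y
      z≢y refl = antisym T z x (proj₁ z⇀x) (proj₁ x⇀y)
      z≢u : z ≢ u
      z≢u refl = nothing-above-u z≺x

  ≺-irrefl : Irreflexive _≡_ _≺_
  ≺-irrefl refl (inj₁ (x↝x , _))     = arc-distinct x↝x refl
  ≺-irrefl refl (inj₂ (x≡v , x≡u))   = u≢v (trans (sym x≡u) x≡v)

  ≺-asym : Asymmetric _≺_
  ≺-asym x≺y y≺x = ≺-irrefl refl (≺-trans x≺y y≺x)

  ≺-connex : ∀ {x y} → x ≢ y → x ≺ y ⊎ y ≺ x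
  ≺-connex {x} {y} x≢y with total T x y x≢y
  ... | inj₁ x↝y = [ inj₁ ∘ inj₁ , (λ { (x≡u , y≡v) → inj₂ (inj₂ (y≡v , x≡u)) }) ]′ (arc-split x↝y)
  ... | inj₂ y↝x = [ inj₂ ∘ inj₁ , (λ { (y≡u , x≡v) → inj₁ (inj₂ (x≡v , y≡u)) }) ]′ (arc-split y↝x)

  ≺-isStrictTotalOrder : IsStrictTotalOrder _≡_ _≺_
  ≺-isStrictTotalOrder = record
    { isStrictPartialOrder = record
      { isEquivalence = isEquivalence
      ; irrefl        = ≺-irrefl
      ; trans         = ≺-trans
      ; <-resp-≈      = resp₂ _≺_
      }
    ; compare = trichotomous _≟_ ≺-irrefl ≺-asym ≺-connex
    }


  open Ranking ≺-isStrictTotalOrder public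
    using (rank; ranking; toℕ-ranking; ranking-bijection)
  open Ranking ≺-isStrictTotalOrder
    using (rank-mono; rank-reflect; rank-injective; rank-least; rank-greatest)

  rank-v : rank v ≡ 0
  rank-v = rank-least v-least

  rank-u : rank u ≡ n ∸ 1
  rank-u = rank-greatest u-greatest

  -- Ranks turn arcs of T into arcs of D_n: an arc other than u → v goes up,
  -- and cannot go from rank 0 (= v) to rank n-1 (= u) as u → v is an arc.
  arc⇒DArc : ∀ {x y} → x ↝ y → DArc n (rank x) (rank y)
  arc⇒DArc x↝y with arc-split x↝y
  ... | inj₂ (refl , refl) = inj₂ (rank-u , rank-v)
  ... | inj₁ x⇀y           = inj₁ (rank-mono (inj₁ x⇀y) , not-v→u)
    where
      not-v→u : ¬ (rank _ ≡ 0 × rank _ ≡ n ∸ 1)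
      not-v→u (x-bottom , y-top)
        with rank-injective (trans x-bottom (sym rank-v)) | rank-injective (trans y-top (sym rank-u))
      ... | refl | refl = antisym T u v u↝v (proj₁ x⇀y)

  DArc⇒arc : ∀ {x y} → DArc n (rank x) (rank y) → x ↝ y
  DArc⇒arc (inj₂ (x-top , y-bottom))
    with rank-injective (trans x-top (sym rank-u)) | rank-injective (trans y-bottom (sym rank-v))
  ... | refl | refl = u↝v
  DArc⇒arc (inj₁ (up , not-v→u)) with rank-reflect up
  ... | inj₁ (x↝y , _)     = x↝y
  ... | inj₂ (refl , refl) = ⊥-elim (not-v→u (rank-v , rank-u))

  isoToD : IsoToD T
  isoToD = record
    { f        = ranking-bijection
    ; preserve = λ x y → toDEdge x y ∘ arc⇒DArc
    ; reflect  = λ x y → DArc⇒arc ∘ fromDEdge x y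
    }
    where
      toDEdge : ∀ x y → DArc n (rank x) (rank y) → DEdge n (ranking x) (ranking y)
      toDEdge x y = subst₂ (DArc n) (sym (toℕ-ranking x)) (sym (toℕ-ranking y))
      fromDEdge : ∀ x y → DEdge n (ranking x) (ranking y) → DArc n (rank x) (rank y)
      fromDEdge x y = subst₂ (DArc n) (toℕ-ranking x) (toℕ-ranking y)

mainTheorem12 : (n : ℕ) (T : Tournament n) → StronglyConnected T →
    (u v : Fin n) → _⇒_ T u v →
    ((C : DirectedCycle T) → ContainsArc C u v) →
    Σ (IsoToD T) λ φ →
      toℕ (Bijection.to (f φ) u) ≡ n ∸ 1 × toℕ (Bijection.to (f φ) v) ≡ 0
mainTheorem12 n T strong u v u↝v onEveryCycle =
  isoToD , trans (toℕ-ranking u) rank-u , trans (toℕ-ranking v) rank-v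
  where open ArcOnEveryCycle T strong u v u↝v onEveryCycle
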